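{- Let $k\geq 5$ and let $G$ be a connected graph on at least $k+1$ vertices with $m(G)<(k+1)/2$ such that $G$ is a single $K_k$-component. Let $v$ be a vertex of minimum degree in $G$. Then exactly one of the following configurations occurs: ($X_\ell$) for some $1\leq \ell\leq k-2$, $K(v)$ is a $K_k$, $R(v)$ is a $K_\ell$ and $S(v)$ is a $K_{k-\ell}$; ($Y_\ell$) for some $1\leq\ell\leq k-2$, $K(v)$ is a $K_{k+1}^-$, $R(v)$ is a $K_\ell$ and $S(v)$ is a $K_{k-\ell+1}^-$; ($U_1$) $K(v)$ is a $K_{k+1}$, $R(v)$ is a $K_1$ and $S(v)$ is a $K_k$.
   Context: $m(G)=\max\{|E(J)|/|V(J)|\colon J\subseteq G,\ |V(J)|\geq1\}$. $K_t^-$ denotes $K_t$ with one edge removed. Two copies of $K_k$ in $G$ are $K_k$-connected if they lie in the same connected component of the auxiliary graph whose vertices are the copies of $K_k$ in $G$, two being adjacent if they share an edge. $G$ is a single $K_k$-component if every vertex and every edge of $G$ lies in a copy of $K_k$ and every two copies of $K_k$ in $G$ are $K_k$-connected. For a vertex $v$: $K(v)$ is the subgraph of $G$ induced on $\{v\}\cup N(v)$; $R(v)$ is the subgraph induced on $\{v\}\cup\{w\in N(v)\colon$ every copy of $K_k$ containing $w$ also contains $v\}$; $S(v)$ is the subgraph induced on $V(K(v))\setminus V(R(v))$. "Is a $K_t$" means is isomorphic to $K_t$. -}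

module Defs where

open import Data.Nat using (ℕ; zero; suc; _+_; _*_; _∸_; _≤_; _<_; _<ᵇ_; _≡ᵇ_)
open import Data.Fin using (Fin; toℕ; _≟_) renaming (zero to fzero; suc to fsuc)
open import Data.Bool using (Bool; true; false; not; _∧_; if_then_else_)
open import Data.Product using (Σ; ∃; _×_; _,_)
open import Data.Sum using (_⊎_)
open import Relation.Nullary using (¬_)
open import Relation.Nullary.Decidable using (⌊_⌋)
open import Relation.Binary.PropositionalEquality using (_≡_; _≢_)
open import Relation.Binary.Construct.Closure.ReflexiveTransitive using (Star)

record Graph (n : ℕ) : Set where
  field
    adj        : Fin n → Fin n → Bool
    adj-sym    : ∀ i j → adj i j ≡ adj j i
    adj-irrefl : ∀ i → adj i i ≡ false
open Graph public

Edge : ∀ {n} → Graph n → Fin n → Fin n → Set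
Edge G i j = adj G i j ≡ true

count : ∀ {n} → (Fin n → Bool) → ℕ
count {zero}  f = 0
count {suc n} f = (if f fzero then 1 else 0) + count (λ i → f (fsuc i))

sumFin : ∀ {n} → (Fin n → ℕ) → ℕ
sumFin {zero}  f = 0
sumFin {suc n} f = f fzero + sumFin (λ i → f (fsuc i))

record Subgraph {n : ℕ} (G : Graph n) : Set where
  field
    vs     : Fin n → Bool
    es     : Fin n → Fin n → Bool
    es-sym : ∀ i j → es i j ≡ es j i
    es-sub : ∀ i j → es i j ≡ true → (adj G i j ≡ true) × (vs i ≡ true) × (vs j ≡ true)
open Subgraph public

|V| : ∀ {n} {G : Graph n} → Subgraph G → ℕ
|V| J = count (vs J)

|E| : ∀ {n} {G : Graph n} → Subgraph G → ℕ
|E| J = sumFin (λ i → count (λ j → (toℕ i <ᵇ toℕ j) ∧ es J i j))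

-- m(G) < (k+1)/2, i.e. |E(J)|/|V(J)| < (k+1)/2 for every subgraph J with |V(J)| ≥ 1
-- (cleared of denominators; the max over finitely many J is < c iff every ratio is < c).
mBelowHalf : ∀ {n} → Graph n → ℕ → Set
mBelowHalf G k = ∀ (J : Subgraph G) → 1 ≤ |V| J → 2 * |E| J < (suc k) * |V| J

Connected : ∀ {n} → Graph n → Set
Connected G = ∀ x y → Star (Edge G) x y

deg : ∀ {n} → Graph n → Fin n → ℕ
deg G v = count (adj G v)

MinDegree : ∀ {n} → Graph n → Fin n → Set
MinDegree G v = ∀ w → deg G v ≤ deg G w

IsCopy : ∀ {n} → ℕ → Graph n → Set
IsCopy {n} k G = Σ (Fin k → Fin n) λ f →
  (∀ i j → f i ≡ f j → i ≡ j) × (∀ i j → i ≢ j → Edge G (f i) (f j))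

InCopy : ∀ {n k} (G : Graph n) → Fin n → IsCopy k G → Set
InCopy G x (f , _) = ∃ λ i → f i ≡ x

ShareEdge : ∀ {n k} (G : Graph n) → IsCopy k G → IsCopy k G → Set
ShareEdge G C D = ∃ λ u → ∃ λ v →
  u ≢ v × Edge G u v × InCopy G u C × InCopy G v C × InCopy G u D × InCopy G v D

KConnected : ∀ {n} (k : ℕ) (G : Graph n) → IsCopy k G → IsCopy k G → Set
KConnected k G = Star (ShareEdge G)

SingleKComponent : ∀ {n} → ℕ → Graph n → Set
SingleKComponent k G =
  (∀ x → Σ (IsCopy k G) λ C → InCopy G x C) ×
  (∀ x y → Edge G x y → Σ (IsCopy k G) λ C → InCopy G x C × InCopy G y C) ×
  (∀ C D → KConnected k G C D)

VSet : ℕ → Set₁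
VSet n = Fin n → Set

InducedIso : ∀ {n} → Graph n → VSet n → (t : ℕ) → (Fin t → Fin t → Bool) → Set
InducedIso {n} G W t H = Σ (Fin t → Fin n) λ f →
  (∀ i j → f i ≡ f j → i ≡ j) ×
  (∀ x → (W x → ∃ λ i → f i ≡ x) × ((∃ λ i → f i ≡ x) → W x)) ×
  (∀ i j → adj G (f i) (f j) ≡ H i j)

complete : (t : ℕ) → Fin t → Fin t → Bool
complete t i j = not ⌊ i ≟ j ⌋

-- K_t^- on Fin t: K_t with the edge {0,1} removed
completeMinus : (t : ℕ) → Fin t → Fin t → Bool
completeMinus t i j = complete t i j ∧ not ((toℕ i + toℕ j) ≡ᵇ 1)

IsK : ∀ {n} → Graph n → VSet n → ℕ → Set
IsK G W t = InducedIso G W t (complete t)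

IsK⁻ : ∀ {n} → Graph n → VSet n → ℕ → Set
IsK⁻ G W t = InducedIso G W t (completeMinus t)

Kv : ∀ {n} → Graph n → Fin n → VSet n
Kv G v x = (x ≡ v) ⊎ Edge G v x

Rv : ∀ {n} → ℕ → Graph n → Fin n → VSet n
Rv k G v x = (x ≡ v) ⊎ (Edge G v x × (∀ (C : IsCopy k G) → InCopy G x C → InCopy G v C))

Sv : ∀ {n} → ℕ → Graph n → Fin n → VSet n
Sv k G v x = Kv G v x × ¬ Rv k G v x

data Config : Set where
  X : ℕ → Config
  Y : ℕ → Config
  U₁ : Config

Holds : ∀ {n} → ℕ → Graph n → Fin n → Config → Set
Holds k G v (X ℓ) = 1 ≤ ℓ × ℓ ≤ k ∸ 2 ×
  IsK G (Kv G v) k × IsK G (Rv k G v) ℓ × IsK G (Sv k G v) (k ∸ ℓ)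
Holds k G v (Y ℓ) = 1 ≤ ℓ × ℓ ≤ k ∸ 2 ×
  IsK⁻ G (Kv G v) (suc k) × IsK G (Rv k G v) ℓ × IsK⁻ G (Sv k G v) (suc (k ∸ ℓ))
Holds k G v U₁ =
  IsK G (Kv G v) (suc k) × IsK G (Rv k G v) 1 × IsK G (Sv k G v) k

module Submission where

open import Defs
open import Data.Bool using (Bool; true; false; not; _∧_; _∨_; if_then_else_)
import Data.Bool.Properties as Bool
open import Data.Empty using (⊥-elim)
open import Data.Fin using (Fin; toℕ; _≟_) renaming (zero to fzero; suc to fsuc)
import Data.Fin.Properties as Fin
open import Data.Nat using (ℕ; zero; suc; _+_; _*_; _∸_; _≤_; _<_; _<ᵇ_; z≤n; s≤s)
open import Data.Nat.Properties hiding (_≟_)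
open import Algebra.Properties.CommutativeSemigroup +-commutativeSemigroup using (interchange)
open import Data.Product using (Σ; ∃; _×_; _,_; proj₁; proj₂)
open import Data.Sum using (_⊎_; inj₁; inj₂)
open import Function using (_∘_)
open import Relation.Binary.Construct.Closure.ReflexiveTransitive using (Star; ε; _◅_)
open import Relation.Binary.PropositionalEquality
open import Relation.Nullary using (¬_; Dec; does; yes; no; contradiction)
open import Relation.Nullary.Decidable using (¬?; _×-dec_; _→-dec_; decidable-stable)

-- Handshaking on G itself turns m(G) < (k+1)/2 into deg v ≤ k, while the copy of K_k
-- through v gives deg v ≥ k − 1. If deg v = k − 1, K(v) is that copy. If deg v = k, a
-- copy through v misses exactly one vertex of K(v): C₀ misses a, and the copy through
-- the edge va misses some b, so K(v) is complete except possibly for ab. If ab is an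
-- edge, N(v) is a copy of K_k avoiding v and R(v) = {v}; otherwise a and b have fewer
-- than k neighbours inside K(v), so they have neighbours outside it and are not in R(v).
-- The bound ℓ ≤ k − 2 comes from K_k-connectivity: a chain of edge-sharing copies from
-- C₀ to a copy leaving K(v) crosses an edge with both ends in S(v). The configurations
-- are mutually exclusive because they differ in the order or shape of K(v) or in |R(v)|.

IsInjective : ∀ {m n} → (Fin m → Fin n) → Set
IsInjective f = ∀ i j → f i ≡ f j → i ≡ j

count-cong : ∀ {n} (P Q : Fin n → Bool) → (∀ i → P i ≡ Q i) → count P ≡ count Q
count-cong {zero}  P Q P≗Q = refl
count-cong {suc n} P Q P≗Q rewrite P≗Q fzero = cong (_ +_) (count-cong (P ∘ fsuc) (Q ∘ fsuc) (P≗Q ∘ fsuc))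

count-mono : ∀ {n} (P Q : Fin n → Bool) → (∀ i → P i ≡ true → Q i ≡ true) → count P ≤ count Q
count-mono {zero}  P Q P⊆Q = z≤n
count-mono {suc n} P Q P⊆Q with P fzero in p₀ | Q fzero in q₀
... | true  | true  = s≤s (count-mono (P ∘ fsuc) (Q ∘ fsuc) (P⊆Q ∘ fsuc))
... | true  | false = contradiction (trans (sym q₀) (P⊆Q fzero p₀)) λ ()
... | false | true  = ≤-trans (count-mono (P ∘ fsuc) (Q ∘ fsuc) (P⊆Q ∘ fsuc)) (n≤1+n _)
... | false | false = count-mono (P ∘ fsuc) (Q ∘ fsuc) (P⊆Q ∘ fsuc)

count-partition : ∀ {n} (Q P : Fin n → Bool) →
  count P ≡ count (λ i → Q i ∧ P i) + count (λ i → not (Q i) ∧ P i)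
count-partition {zero}  Q P = refl
count-partition {suc n} Q P with P fzero | Q fzero
... | true  | true  = cong suc (count-partition (Q ∘ fsuc) (P ∘ fsuc))
... | true  | false = trans (cong suc (count-partition (Q ∘ fsuc) (P ∘ fsuc))) (sym (+-suc _ _))
... | false | true  = count-partition (Q ∘ fsuc) (P ∘ fsuc)
... | false | false = count-partition (Q ∘ fsuc) (P ∘ fsuc)

count-true : ∀ n → count {n} (λ _ → true) ≡ n
count-true zero    = refl
count-true (suc n) = cong suc (count-true n)

without : ∀ {n} → Fin n → (Fin n → Bool) → Fin n → Bool
without x P i = not (does (i ≟ x)) ∧ P i

without-true : ∀ {n} (P : Fin n → Bool) {x i} → i ≢ x → P i ≡ true → without x P i ≡ true
without-true P {x} {i} i≢x Pi with i ≟ x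
... | yes i≡x = contradiction i≡x i≢x
... | no _    = Pi

without-sound : ∀ {n} (P : Fin n → Bool) {x i} → without x P i ≡ true → i ≢ x × P i ≡ true
without-sound P {x} {i} h with i ≟ x | P i
... | no i≢x | true = i≢x , refl

count-without : ∀ {n} (P : Fin n → Bool) x → P x ≡ true → count P ≡ suc (count (without x P))
count-without {suc n} P fzero    Px rewrite Px = refl
count-without {suc n} P (fsuc x) Px with P fzero
... | true  = cong suc (count-without (P ∘ fsuc) x Px)
... | false = count-without (P ∘ fsuc) x Px

count-≥1 : ∀ {n} (P : Fin n → Bool) {x} → P x ≡ true → 1 ≤ count P
count-≥1 P {x} Px rewrite count-without P x Px = s≤s z≤n

count-≥2 : ∀ {n} (P : Fin n → Bool) {x y} → P x ≡ true → P y ≡ true → x ≢ y → 2 ≤ count P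
count-≥2 P {x} Px Py x≢y rewrite count-without P x Px =
  s≤s (count-≥1 (without x P) (without-true P (λ e → x≢y (sym e)) Py))

count-≥3 : ∀ {n} (P : Fin n → Bool) {x y z} → P x ≡ true → P y ≡ true → P z ≡ true →
  x ≢ y → x ≢ z → y ≢ z → 3 ≤ count P
count-≥3 P {x} Px Py Pz x≢y x≢z y≢z rewrite count-without P x Px =
  s≤s (count-≥2 (without x P) (without-true P (λ e → x≢y (sym e)) Py)
                              (without-true P (λ e → x≢z (sym e)) Pz) y≢z)

enum : ∀ {n} (P : Fin n → Bool) → Fin (count P) → Fin n
enum {suc n} P i with P fzero
enum {suc n} P fzero    | true  = fzero
enum {suc n} P (fsuc i) | true  = fsuc (enum (P ∘ fsuc) i)
enum {suc n} P i        | false = fsuc (enum (P ∘ fsuc) i)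

enum-sound : ∀ {n} (P : Fin n → Bool) i → P (enum P i) ≡ true
enum-sound {suc n} P i with P fzero in p₀
enum-sound {suc n} P fzero    | true  = p₀
enum-sound {suc n} P (fsuc i) | true  = enum-sound (P ∘ fsuc) i
enum-sound {suc n} P i        | false = enum-sound (P ∘ fsuc) i

enum-injective : ∀ {n} (P : Fin n → Bool) → IsInjective (enum P)
enum-injective {suc n} P i j e with P fzero
enum-injective {suc n} P fzero    fzero    e  | true = refl
enum-injective {suc n} P (fsuc i) (fsuc j) e  | true = cong fsuc (enum-injective (P ∘ fsuc) i j (Fin.suc-injective e))
enum-injective {suc n} P i        j        e  | false = enum-injective (P ∘ fsuc) i j (Fin.suc-injective e)

enum-complete : ∀ {n} (P : Fin n → Bool) x → P x ≡ true → ∃ λ i → enum P i ≡ x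
enum-complete {suc n} P x Px with P fzero in p₀
enum-complete {suc n} P fzero    Px | true  = fzero , refl
enum-complete {suc n} P fzero    Px | false = contradiction (trans (sym p₀) Px) λ ()
enum-complete {suc n} P (fsuc x) Px | b with enum-complete (P ∘ fsuc) x Px
enum-complete {suc n} P (fsuc x) Px | true  | i , e = fsuc i , cong fsuc e
enum-complete {suc n} P (fsuc x) Px | false | i , e = i , cong fsuc e

injection⇒≤count : ∀ {m n} (P : Fin n → Bool) (g : Fin m → Fin n) →
  IsInjective g → (∀ i → P (g i) ≡ true) → m ≤ count P
injection⇒≤count P g g-inj g⊆P = Fin.injective⇒≤ {f = index} index-injective
  where
  index : _ → Fin (count P)
  index i = proj₁ (enum-complete P (g i) (g⊆P i))
  enum-index : ∀ i → enum P (index i) ≡ g i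
  enum-index i = proj₂ (enum-complete P (g i) (g⊆P i))
  index-injective : ∀ {i j} → index i ≡ index j → i ≡ j
  index-injective {i} {j} e =
    g-inj i j (trans (sym (enum-index i)) (trans (cong (enum P) e) (enum-index j)))

count≤surjection : ∀ {m n} (P : Fin n → Bool) (g : Fin m → Fin n) →
  (∀ x → P x ≡ true → ∃ λ i → g i ≡ x) → count P ≤ m
count≤surjection P g g-onto = Fin.injective⇒≤ {f = preimage} preimage-injective
  where
  preimage : Fin (count P) → _
  preimage j = proj₁ (g-onto (enum P j) (enum-sound P j))
  g-preimage : ∀ j → g (preimage j) ≡ enum P j
  g-preimage j = proj₂ (g-onto (enum P j) (enum-sound P j))
  preimage-injective : ∀ {i j} → preimage i ≡ preimage j → i ≡ j
  preimage-injective {i} {j} e =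
    enum-injective P i j (trans (sym (g-preimage i)) (trans (cong g e) (g-preimage j)))

extend : ∀ {m n} → Fin n → (Fin m → Fin n) → Fin (suc m) → Fin n
extend x g fzero    = x
extend x g (fsuc i) = g i

extend-injective : ∀ {m n} {x : Fin n} {g : Fin m → Fin n} →
  ¬ (∃ λ i → g i ≡ x) → IsInjective g → IsInjective (extend x g)
extend-injective x∉g g-inj fzero    fzero    e = refl
extend-injective x∉g g-inj fzero    (fsuc j) e = contradiction (j , sym e) x∉g
extend-injective x∉g g-inj (fsuc i) fzero    e = contradiction (i , e) x∉g
extend-injective x∉g g-inj (fsuc i) (fsuc j) e = cong fsuc (g-inj i j e)

injection-onto : ∀ {m n} (P : Fin n → Bool) (g : Fin m → Fin n) →
  IsInjective g → (∀ i → P (g i) ≡ true) → count P ≤ m →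
  ∀ x → P x ≡ true → ∃ λ i → g i ≡ x
injection-onto P g g-inj g⊆P bound x Px =
  decidable-stable (Fin.any? (λ i → g i ≟ x)) λ x∉g →
    <⇒≱ (injection⇒≤count P (extend x g) (extend-injective x∉g g-inj) extended⊆P) bound
  where
  extended⊆P : ∀ i → P (extend x g i) ≡ true
  extended⊆P fzero    = Px
  extended⊆P (fsuc i) = g⊆P i

injection-misses-at-most-one : ∀ {m n} (P : Fin n → Bool) (g : Fin m → Fin n) →
  IsInjective g → (∀ i → P (g i) ≡ true) → count P ≤ suc m →
  ∀ x y → P x ≡ true → P y ≡ true →
  ¬ (∃ λ i → g i ≡ x) → ¬ (∃ λ i → g i ≡ y) → y ≡ x
injection-misses-at-most-one P g g-inj g⊆P bound x y Px Py x∉g y∉g =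
  decidable-stable (y ≟ x) λ y≢x →
    y∉g (injection-onto (without x P) g g-inj g⊆P-x bound-x y (without-true P y≢x Py))
  where
  g⊆P-x : ∀ i → without x P (g i) ≡ true
  g⊆P-x i = without-true P (λ gi≡x → x∉g (i , gi≡x)) (g⊆P i)
  bound-x : count (without x P) ≤ _
  bound-x = ≤-pred (subst (_≤ suc _) (count-without P x Px) bound)

∃-missed-by : ∀ {m n} (P : Fin n → Bool) (g : Fin m → Fin n) →
  m < count P → ∃ λ x → P x ≡ true × ¬ (∃ λ i → g i ≡ x)
∃-missed-by P g m<count =
  decidable-stable (Fin.any? (λ x → (P x Bool.≟ true) ×-dec ¬? (Fin.any? (λ i → g i ≟ x))))
    λ none-missed → ≤⇒≯ (count≤surjection P g λ x Px →
      decidable-stable (Fin.any? (λ i → g i ≟ x)) (λ x∉g → none-missed (x , Px , x∉g))) m<count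

count<⇒∃-false : ∀ {n} (P : Fin n → Bool) → count P < n → ∃ λ x → P x ≡ false
count<⇒∃-false {n} P count<n =
  decidable-stable (Fin.any? (λ x → P x Bool.≟ false)) λ none-false →
    <⇒≱ count<n (subst (_≤ count P) (count-true n)
      (count-mono (λ _ → true) P (λ x _ → Bool.¬-not (λ Px → none-false (x , Px)))))

Indicates : ∀ {n} → (Fin n → Bool) → VSet n → Set
Indicates P W = ∀ x → (W x → P x ≡ true) × (P x ≡ true → W x)

Edge-irrefl : ∀ {n} (G : Graph n) {x} → ¬ Edge G x x
Edge-irrefl G {x} xx = contradiction (trans (sym (adj-irrefl G x)) xx) λ ()

Edge-avoids-non-edge : ∀ {n} (G : Graph n) {a b u w} → adj G a b ≡ false → Edge G u w →
  (u ≢ a × u ≢ b) ⊎ (w ≢ a × w ≢ b)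
Edge-avoids-non-edge G {a} {b} {u} {w} ab-free uw with u ≟ a | u ≟ b
... | no u≢a   | no u≢b   = inj₁ (u≢a , u≢b)
... | yes refl | _        = inj₂ ((λ { refl → Edge-irrefl G uw }) , λ { refl → contradiction (trans (sym ab-free) uw) λ () })
... | no _     | yes refl = inj₂ ((λ { refl → contradiction (trans (sym ab-free) (trans (adj-sym G a b) uw)) λ () }) ,
                                  λ { refl → Edge-irrefl G uw })

IsClique : ∀ {n} → Graph n → (Fin n → Bool) → Set
IsClique G P = ∀ x y → P x ≡ true → P y ≡ true → x ≢ y → Edge G x y

IsCliqueExcept : ∀ {n} → Graph n → (Fin n → Bool) → Fin n → Fin n → Set
IsCliqueExcept G P a b = ∀ x y → P x ≡ true → P y ≡ true → x ≢ y →
  ¬ (x ≡ a × y ≡ b) → ¬ (x ≡ b × y ≡ a) → Edge G x y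

IsClique-⊆ : ∀ {n} (G : Graph n) {P Q : Fin n → Bool} →
  (∀ x → Q x ≡ true → P x ≡ true) → IsClique G P → IsClique G Q
IsClique-⊆ G Q⊆P clique x y Qx Qy = clique x y (Q⊆P x Qx) (Q⊆P y Qy)

IsCliqueExcept-⊆ : ∀ {n} (G : Graph n) {P Q : Fin n → Bool} {a b} →
  (∀ x → Q x ≡ true → P x ≡ true) → IsCliqueExcept G P a b → IsCliqueExcept G Q a b
IsCliqueExcept-⊆ G Q⊆P clique x y Qx Qy = clique x y (Q⊆P x Qx) (Q⊆P y Qy)

clique⇒IsCopy : ∀ {n} (G : Graph n) (P : Fin n → Bool) → IsClique G P →
  Σ (IsCopy (count P) G) λ C → Indicates P (λ x → InCopy G x C)
clique⇒IsCopy G P clique =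
  (enum P , enum-injective P ,
   λ i j i≢j → clique _ _ (enum-sound P i) (enum-sound P j) (i≢j ∘ enum-injective P i j)) ,
  λ x → (λ { (i , refl) → enum-sound P i }) , enum-complete P x

singleton⇒IsK : ∀ {n} (G : Graph n) {W : VSet n} v → (∀ x → (W x → x ≡ v) × (x ≡ v → W x)) → IsK G W 1
singleton⇒IsK G v W≈v =
  (λ _ → v) , (λ { fzero fzero _ → refl }) ,
  (λ x → (λ Wx → fzero , sym (proj₁ (W≈v x) Wx)) , (λ { (fzero , refl) → proj₂ (W≈v v) refl })) ,
  (λ { fzero fzero → adj-irrefl G v })

clique⇒IsK : ∀ {n} (G : Graph n) {W : VSet n} (P : Fin n → Bool) →
  Indicates P W → IsClique G P → IsK G W (count P)
clique⇒IsK G P P≈W clique = enum P , enum-injective P , enum-covers , adjacency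
  where
  enum-covers : ∀ x → _
  enum-covers x = (λ Wx → enum-complete P x (proj₁ (P≈W x) Wx)) ,
                  (λ { (i , refl) → proj₂ (P≈W _) (enum-sound P i) })
  adjacency : ∀ i j → adj G (enum P i) (enum P j) ≡ complete _ i j
  adjacency i j with i ≟ j
  ... | yes refl = adj-irrefl G _
  ... | no i≢j  = clique _ _ (enum-sound P i) (enum-sound P j) (i≢j ∘ enum-injective P i j)

-- The listing puts the missing edge {a, b} in positions 0 and 1, as completeMinus requires.
cliqueExcept⇒IsK⁻ : ∀ {n} (G : Graph n) {W : VSet n} (P : Fin n → Bool) {a b : Fin n} →
  Indicates P W → P a ≡ true → P b ≡ true → a ≢ b → adj G a b ≡ false →
  IsCliqueExcept G P a b → IsK⁻ G W (count P)
cliqueExcept⇒IsK⁻ {n} G {W} P {a} {b} P≈W Pa Pb a≢b ab-free clique =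
  subst (IsK⁻ G W) (sym size) (f , f-injective , f-covers , adjacency)
  where
  rest : Fin n → Bool
  rest = without b (without a P)

  rest-sound : ∀ x → rest x ≡ true → x ≢ a × x ≢ b × P x ≡ true
  rest-sound x h with without-sound (without a P) h
  ... | x≢b , h′ with without-sound P h′
  ...   | x≢a , Px = x≢a , x≢b , Px

  size : count P ≡ suc (suc (count rest))
  size = trans (count-without P a Pa)
    (cong suc (count-without (without a P) b (without-true P (λ b≡a → a≢b (sym b≡a)) Pb)))

  f : Fin (suc (suc (count rest))) → Fin n
  f fzero           = a
  f (fsuc fzero)    = b
  f (fsuc (fsuc i)) = enum rest i

  listed : ∀ i → rest (enum rest i) ≡ true
  listed = enum-sound rest

  f⊆P : ∀ i → P (f i) ≡ true
  f⊆P fzero           = Pa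
  f⊆P (fsuc fzero)    = Pb
  f⊆P (fsuc (fsuc i)) = proj₂ (proj₂ (rest-sound _ (listed i)))

  e≢a : ∀ i → enum rest i ≢ a
  e≢a i = proj₁ (rest-sound _ (listed i))
  e≢b : ∀ i → enum rest i ≢ b
  e≢b i = proj₁ (proj₂ (rest-sound _ (listed i)))

  f-injective : IsInjective f
  f-injective fzero           fzero           e = refl
  f-injective fzero           (fsuc fzero)    e = ⊥-elim (a≢b e)
  f-injective fzero           (fsuc (fsuc j)) e = ⊥-elim (e≢a j (sym e))
  f-injective (fsuc fzero)    fzero           e = ⊥-elim (a≢b (sym e))
  f-injective (fsuc fzero)    (fsuc fzero)    e = refl
  f-injective (fsuc fzero)    (fsuc (fsuc j)) e = ⊥-elim (e≢b j (sym e))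
  f-injective (fsuc (fsuc i)) fzero           e = ⊥-elim (e≢a i e)
  f-injective (fsuc (fsuc i)) (fsuc fzero)    e = ⊥-elim (e≢b i e)
  f-injective (fsuc (fsuc i)) (fsuc (fsuc j)) e = cong (fsuc ∘ fsuc) (enum-injective rest i j e)

  f-covers : ∀ x → (W x → ∃ λ i → f i ≡ x) × ((∃ λ i → f i ≡ x) → W x)
  f-covers x = covered , (λ { (i , refl) → proj₂ (P≈W _) (f⊆P i) })
    where
    covered : W x → ∃ λ i → f i ≡ x
    covered Wx with x ≟ a | x ≟ b
    ... | yes refl | _        = fzero , refl
    ... | no _     | yes refl = fsuc fzero , refl
    ... | no x≢a   | no x≢b   with enum-complete rest x
                                     (without-true (without a P) x≢b (without-true P x≢a (proj₁ (P≈W x) Wx)))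
    ...   | i , e = fsuc (fsuc i) , e

  edge : ∀ i j → i ≢ j → ¬ (f i ≡ a × f j ≡ b) → ¬ (f i ≡ b × f j ≡ a) → Edge G (f i) (f j)
  edge i j i≢j = clique (f i) (f j) (f⊆P i) (f⊆P j) (i≢j ∘ f-injective i j)

  adjacency : ∀ i j → adj G (f i) (f j) ≡ completeMinus (suc (suc (count rest))) i j
  adjacency fzero fzero = adj-irrefl G a
  adjacency fzero (fsuc fzero) = ab-free
  adjacency fzero (fsuc (fsuc j)) =
    edge fzero (fsuc (fsuc j)) (λ ()) (e≢b j ∘ proj₂) (a≢b ∘ proj₁)
  adjacency (fsuc fzero) fzero = trans (adj-sym G b a) ab-free
  adjacency (fsuc fzero) (fsuc fzero) = adj-irrefl G b
  adjacency (fsuc fzero) (fsuc (fsuc j)) =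
    edge (fsuc fzero) (fsuc (fsuc j)) (λ ()) (a≢b ∘ sym ∘ proj₁) (e≢a j ∘ proj₂)
  adjacency (fsuc (fsuc i)) fzero =
    edge (fsuc (fsuc i)) fzero (λ ()) (e≢a i ∘ proj₁) (e≢b i ∘ proj₁)
  adjacency (fsuc (fsuc i)) (fsuc fzero) =
    edge (fsuc (fsuc i)) (fsuc fzero) (λ ()) (e≢a i ∘ proj₁) (e≢b i ∘ proj₁)
  adjacency (fsuc (fsuc i)) (fsuc (fsuc j)) with i ≟ j
  ... | yes refl = adj-irrefl G _
  ... | no i≢j   = edge (fsuc (fsuc i)) (fsuc (fsuc j))
                     (i≢j ∘ Fin.suc-injective ∘ Fin.suc-injective) (e≢a i ∘ proj₁) (e≢b i ∘ proj₁)

complete-≢ : ∀ {t} {i j : Fin t} → i ≢ j → complete t i j ≡ true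
complete-≢ {i = i} {j} i≢j with i ≟ j
... | yes i≡j = contradiction i≡j i≢j
... | no _    = refl

InducedIso-size-≤ : ∀ {n} {G : Graph n} {W : VSet n} {t t′ H H′} →
  InducedIso G W t H → InducedIso G W t′ H′ → t ≤ t′
InducedIso-size-≤ (f , f-inj , f-covers , _) (g , g-inj , g-covers , _) =
  Fin.injective⇒≤ {f = index} (λ {i} {j} e →
    f-inj i j (trans (sym (proj₂ (in-g i))) (trans (cong g e) (proj₂ (in-g j)))))
  where
  in-g : ∀ i → ∃ λ j → g j ≡ f i
  in-g i = proj₁ (g-covers (f i)) (proj₂ (f-covers (f i)) (i , refl))
  index : _ → _
  index i = proj₁ (in-g i)

InducedIso-size-unique : ∀ {n} {G : Graph n} {W : VSet n} {t t′ H H′} →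
  InducedIso G W t H → InducedIso G W t′ H′ → t ≡ t′
InducedIso-size-unique {G = G} I J = ≤-antisym (InducedIso-size-≤ {G = G} I J) (InducedIso-size-≤ {G = G} J I)

¬IsK⁻×IsK : ∀ {n} (G : Graph n) (W : VSet n) t → IsK⁻ G W (suc (suc t)) → ¬ IsK G W (suc (suc t))
¬IsK⁻×IsK G W t (f , f-inj , f-covers , f-adj) (g , g-inj , g-covers , g-adj)
  with proj₁ (g-covers (f fzero)) (proj₂ (f-covers _) (fzero , refl))
     | proj₁ (g-covers (f (fsuc fzero))) (proj₂ (f-covers _) (fsuc fzero , refl))
... | i , gi | j , gj with i ≟ j
... | yes refl = contradiction (f-inj fzero (fsuc fzero) (trans (sym gi) gj)) λ ()
... | no i≢j  = contradiction
      (trans (sym (f-adj fzero (fsuc fzero)))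
        (trans (cong₂ (adj G) (sym gi) (sym gj)) (trans (g-adj i j) (complete-≢ i≢j))))
      λ ()

sumFin-cong : ∀ {n} (f g : Fin n → ℕ) → (∀ i → f i ≡ g i) → sumFin f ≡ sumFin g
sumFin-cong {zero}  f g f≗g = refl
sumFin-cong {suc n} f g f≗g = cong₂ _+_ (f≗g fzero) (sumFin-cong (f ∘ fsuc) (g ∘ fsuc) (f≗g ∘ fsuc))

sumFin-mono : ∀ {n} (f g : Fin n → ℕ) → (∀ i → f i ≤ g i) → sumFin f ≤ sumFin g
sumFin-mono {zero}  f g f≤g = z≤n
sumFin-mono {suc n} f g f≤g = +-mono-≤ (f≤g fzero) (sumFin-mono (f ∘ fsuc) (g ∘ fsuc) (f≤g ∘ fsuc))

sumFin-const : ∀ n d → sumFin {n} (λ _ → d) ≡ n * d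
sumFin-const zero    d = refl
sumFin-const (suc n) d = cong (d +_) (sumFin-const n d)

sumFin-+ : ∀ {n} (f g : Fin n → ℕ) → sumFin (λ i → f i + g i) ≡ sumFin f + sumFin g
sumFin-+ {zero}  f g = refl
sumFin-+ {suc n} f g = trans (cong (f fzero + g fzero +_) (sumFin-+ (f ∘ fsuc) (g ∘ fsuc)))
  (interchange (f fzero) (g fzero) (sumFin (f ∘ fsuc)) (sumFin (g ∘ fsuc)))

sumFin-swap : ∀ {m n} (F : Fin m → Fin n → ℕ) →
  sumFin (λ i → sumFin (F i)) ≡ sumFin (λ j → sumFin (λ i → F i j))
sumFin-swap {zero}  {n} F = sym (trans (sumFin-const n 0) (*-zeroʳ n))
sumFin-swap {suc m} {n} F = trans (cong (sumFin (F fzero) +_) (sumFin-swap (F ∘ fsuc)))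
  (sym (sumFin-+ (F fzero) (λ j → sumFin (λ i → F (fsuc i) j))))

count-as-sumFin : ∀ {n} (P : Fin n → Bool) → count P ≡ sumFin (λ i → if P i then 1 else 0)
count-as-sumFin {zero}  P = refl
count-as-sumFin {suc n} P = cong ((if P fzero then 1 else 0) +_) (count-as-sumFin (P ∘ fsuc))

<ᵇ-flip : ∀ m n → m ≢ n → not (m <ᵇ n) ≡ (n <ᵇ m)
<ᵇ-flip zero    zero    m≢n = contradiction refl m≢n
<ᵇ-flip zero    (suc n) m≢n = refl
<ᵇ-flip (suc m) zero    m≢n = refl
<ᵇ-flip (suc m) (suc n) m≢n = <ᵇ-flip m n (m≢n ∘ cong suc)

module _ {n} (G : Graph n) where

  ascendingAdj : Fin n → Fin n → Bool
  ascendingAdj i j = (toℕ i <ᵇ toℕ j) ∧ adj G i j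

  descendingAdj≡flip : ∀ i j → (not (toℕ i <ᵇ toℕ j) ∧ adj G i j) ≡ ascendingAdj j i
  descendingAdj≡flip i j with i ≟ j
  ... | yes refl rewrite adj-irrefl G i = trans (Bool.∧-zeroʳ _) (sym (Bool.∧-zeroʳ _))
  ... | no i≢j  = cong₂ _∧_ (<ᵇ-flip _ _ (i≢j ∘ Fin.toℕ-injective)) (adj-sym G i j)

  wholeGraph : Subgraph G
  wholeGraph = record { vs = λ _ → true ; es = adj G ; es-sym = adj-sym G
                      ; es-sub = λ i j e → e , refl , refl }

  handshake : sumFin (deg G) ≡ 2 * |E| wholeGraph
  handshake = begin
    sumFin (λ i → count (adj G i))
      ≡⟨ sumFin-cong _ _ (λ i → count-partition (λ j → toℕ i <ᵇ toℕ j) (adj G i)) ⟩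
    sumFin (λ i → count (ascendingAdj i) + count (λ j → not (toℕ i <ᵇ toℕ j) ∧ adj G i j))
      ≡⟨ sumFin-+ (λ i → count (ascendingAdj i)) _ ⟩
    E + sumFin (λ i → count (λ j → not (toℕ i <ᵇ toℕ j) ∧ adj G i j))
      ≡⟨ cong (E +_) (sumFin-cong _ _ (λ i →
           trans (count-cong _ _ (descendingAdj≡flip i)) (count-as-sumFin (λ j → ascendingAdj j i)))) ⟩
    E + sumFin (λ i → sumFin (λ j → if ascendingAdj j i then 1 else 0))
      ≡⟨ cong (E +_) (sumFin-swap (λ i j → if ascendingAdj j i then 1 else 0)) ⟩
    E + sumFin (λ j → sumFin (λ i → if ascendingAdj j i then 1 else 0))
      ≡⟨ cong (E +_) (sumFin-cong _ _ (λ j → sym (count-as-sumFin (ascendingAdj j)))) ⟩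
    E + E
      ≡⟨ cong (E +_) (sym (+-identityʳ E)) ⟩
    2 * E ∎
    where
    open ≡-Reasoning
    E = |E| wholeGraph

minDegree≤ : ∀ {n} (k : ℕ) (G : Graph n) → mBelowHalf G k → (v : Fin n) → MinDegree G v → deg G v ≤ k
minDegree≤ {n} k G m<k+1/2 v minimal = ≤-pred (*-cancelˡ-< n (deg G v) (suc k) (begin-strict
  n * deg G v             ≡⟨ sym (sumFin-const n (deg G v)) ⟩
  sumFin {n} (λ _ → deg G v) ≤⟨ sumFin-mono (λ _ → deg G v) (deg G) minimal ⟩
  sumFin (deg G)          ≡⟨ handshake G ⟩
  2 * |E| (wholeGraph G)  <⟨ m<k+1/2 (wholeGraph G) 1≤|V| ⟩
  suc k * count {n} (λ _ → true) ≡⟨ cong (suc k *_) (count-true n) ⟩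
  suc k * n               ≡⟨ *-comm (suc k) n ⟩
  n * suc k               ∎))
  where
  open ≤-Reasoning
  1≤|V| : 1 ≤ count {n} (λ _ → true)
  1≤|V| = count-≥1 (λ _ → true) {v} refl

Star-boundary : ∀ {A : Set} {R : A → A → Set} {Q : A → Set} → (∀ a → Dec (Q a)) →
  ∀ {a b} → Star R a b → Q a → ¬ Q b → ∃ λ a′ → ∃ λ b′ → Q a′ × ¬ Q b′ × R a′ b′
Star-boundary Q? ε Qa ¬Qb = contradiction Qa ¬Qb
Star-boundary Q? {a} (_◅_ {j = c} r rs) Qa ¬Qb with Q? c
... | yes Qc = Star-boundary Q? rs Qc ¬Qb
... | no ¬Qc = a , c , Qa , ¬Qc , r

anyMap? : ∀ k {n} (P : (Fin k → Fin n) → Set) → (∀ f → Dec (P f)) →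
  (∀ f g → (∀ i → f i ≡ g i) → P f → P g) → Dec (Σ (Fin k → Fin n) P)
anyMap? zero P P? P-resp with P? (λ ())
... | yes Pf = yes (_ , Pf)
... | no ¬Pf = no λ { (f , Pf) → ¬Pf (P-resp f _ (λ ()) Pf) }
anyMap? (suc k) P P? P-resp
  with Fin.any? (λ x → anyMap? k (P ∘ extend x) (P? ∘ extend x)
         (λ f g f≗g → P-resp (extend x f) (extend x g) λ { fzero → refl ; (fsuc i) → f≗g i }))
... | yes (x , f , Pf) = yes (extend x f , Pf)
... | no none = no λ { (f , Pf) → none (f fzero , f ∘ fsuc ,
                        P-resp f _ (λ { fzero → refl ; (fsuc i) → refl }) Pf) }

module _ {n k : ℕ} (G : Graph n) where

  InCopy? : ∀ x (C : IsCopy k G) → Dec (InCopy G x C)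
  InCopy? x (f , _) = Fin.any? (λ i → f i ≟ x)

  InCopy-adjacent : (C : IsCopy k G) → ∀ {x y} → InCopy G x C → InCopy G y C → x ≢ y → Edge G x y
  InCopy-adjacent (f , _ , f-edge) (i , refl) (j , refl) fi≢fj = f-edge i j (fi≢fj ∘ cong f)

module _ {n} (k : ℕ) (G : Graph n) where

  MapsCopyAvoiding : Fin n → Fin n → (Fin k → Fin n) → Set
  MapsCopyAvoiding x v f = (IsInjective f × (∀ i j → i ≢ j → Edge G (f i) (f j))) ×
                           (∃ λ i → f i ≡ x) × ¬ (∃ λ i → f i ≡ v)

  MapsCopyAvoiding? : ∀ x v f → Dec (MapsCopyAvoiding x v f)
  MapsCopyAvoiding? x v f =
    (Fin.all? (λ i → Fin.all? (λ j → (f i ≟ f j) →-dec (i ≟ j))) ×-dec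
     Fin.all? (λ i → Fin.all? (λ j → ¬? (i ≟ j) →-dec (adj G (f i) (f j) Bool.≟ true)))) ×-dec
    Fin.any? (λ i → f i ≟ x) ×-dec ¬? (Fin.any? (λ i → f i ≟ v))

  MapsCopyAvoiding-resp : ∀ x v f g → (∀ i → f i ≡ g i) → MapsCopyAvoiding x v f → MapsCopyAvoiding x v g
  MapsCopyAvoiding-resp x v f g f≗g ((f-inj , f-edge) , (i , fi≡x) , v∉f) =
    ((λ i j e → f-inj i j (trans (f≗g i) (trans e (sym (f≗g j))))) ,
     (λ i j i≢j → subst₂ (Edge G) (f≗g i) (f≗g j) (f-edge i j i≢j))) ,
    (i , trans (sym (f≗g i)) fi≡x) , (λ { (j , gj≡v) → v∉f (j , trans (f≗g j) gj≡v) })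

  copyAvoiding? : ∀ x v → Dec (Σ (IsCopy k G) λ C → InCopy G x C × ¬ InCopy G v C)
  copyAvoiding? x v with anyMap? k (MapsCopyAvoiding x v) (MapsCopyAvoiding? x v) (MapsCopyAvoiding-resp x v)
  ... | yes (f , isCopy , x∈f , v∉f) = yes ((f , isCopy) , x∈f , v∉f)
  ... | no none = no λ { ((f , isCopy) , x∈f , v∉f) → none (f , isCopy , x∈f , v∉f) }

  Rv? : ∀ v x → Dec (Rv k G v x)
  Rv? v x with x ≟ v
  ... | yes x≡v = yes (inj₁ x≡v)
  ... | no x≢v with adj G v x Bool.≟ true
  ...   | no ¬vx = no λ { (inj₁ x≡v) → x≢v x≡v ; (inj₂ (vx , _)) → ¬vx vx }
  ...   | yes vx with copyAvoiding? x v
  ...     | yes (C , x∈C , v∉C) = no λ { (inj₁ x≡v) → x≢v x≡v ; (inj₂ (_ , x⇒v)) → v∉C (x⇒v C x∈C) }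
  ...     | no none = yes (inj₂ (vx , λ C x∈C →
                decidable-stable (InCopy? G v C) (λ v∉C → none (C , x∈C , v∉C))))

module Neighbourhood {n} (k : ℕ) (G : Graph n) (v : Fin n) where

  inK : Fin n → Bool
  inK x = does (x ≟ v) ∨ adj G v x

  inK-indicates : Indicates inK (Kv G v)
  inK-indicates x with x ≟ v
  ... | yes refl = (λ _ → refl) , (λ _ → inj₁ refl)
  ... | no x≢v  = (λ { (inj₁ x≡v) → contradiction x≡v x≢v ; (inj₂ vx) → vx }) , inj₂

  count-inK : count inK ≡ suc (deg G v)
  count-inK = trans (count-without inK v (proj₁ (inK-indicates v) (inj₁ refl)))
                    (cong suc (count-cong (without v inK) (adj G v) neighbour))
    where
    neighbour : ∀ x → without v inK x ≡ adj G v x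
    neighbour x with x ≟ v
    ... | yes refl = sym (adj-irrefl G v)
    ... | no _     = refl

  inR : Fin n → Bool
  inR x = does (Rv? k G v x)

  inR-indicates : Indicates inR (Rv k G v)
  inR-indicates x with Rv? k G v x
  ... | yes Rx = (λ _ → refl) , (λ _ → Rx)
  ... | no ¬Rx = (λ Rx → contradiction Rx ¬Rx) , λ ()

  inS : Fin n → Bool
  inS x = not (inR x) ∧ inK x

  inS-indicates : Indicates inS (Sv k G v)
  inS-indicates x with Rv? k G v x
  ... | yes Rx = (λ { (_ , ¬Rx) → contradiction Rx ¬Rx }) , λ ()
  ... | no ¬Rx = (λ { (Kx , _) → proj₁ (inK-indicates x) Kx }) ,
                 (λ Kx → proj₂ (inK-indicates x) Kx , ¬Rx)

  inR⇒inK : ∀ x → inR x ≡ true → inK x ≡ true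
  inR⇒inK x Rx with proj₂ (inR-indicates x) Rx
  ... | inj₁ x≡v      = proj₁ (inK-indicates x) (inj₁ x≡v)
  ... | inj₂ (vx , _) = proj₁ (inK-indicates x) (inj₂ vx)

  inS⇒inK : ∀ x → inS x ≡ true → inK x ≡ true
  inS⇒inK x Sx with inR x
  ... | false = Sx

  count-inK-split : count inK ≡ count inR + count inS
  count-inK-split = trans (count-partition inR inK)
                          (cong (_+ count inS) (count-cong (λ x → inR x ∧ inK x) inR R∧K≡R))
    where
    R∧K≡R : ∀ x → (inR x ∧ inK x) ≡ inR x
    R∧K≡R x with inR x in Rx
    ... | true  = inR⇒inK x Rx
    ... | false = refl

  1≤count-inR : 1 ≤ count inR
  1≤count-inR = count-≥1 inR {v} (proj₁ (inR-indicates v) (inj₁ refl))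

  copy⊆K : (C : IsCopy k G) → InCopy G v C → ∀ {x} → InCopy G x C → inK x ≡ true
  copy⊆K C v∈C {x} x∈C with x ≟ v
  ... | yes _   = refl
  ... | no x≢v  = InCopy-adjacent G C v∈C x∈C (x≢v ∘ sym)

  ¬Rv-of-copy : (C : IsCopy k G) → ¬ InCopy G v C → ∀ {x} → InCopy G x C → ¬ Rv k G v x
  ¬Rv-of-copy C v∉C x∈C (inj₁ refl)    = v∉C x∈C
  ¬Rv-of-copy C v∉C x∈C (inj₂ (_ , x⇒v)) = v∉C (x⇒v C x∈C)

split-bound : ∀ r s t c → r + s ≡ t → c ≤ s → r ≤ t ∸ c
split-bound r s t c r+s≡t c≤s = m+n≤o⇒m≤o∸n r (subst (r + c ≤_) r+s≡t (+-monoʳ-≤ r c≤s))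

module AtMinDegreeVertex {n} (k : ℕ) (G : Graph n) (single : SingleKComponent k G)
                         (v : Fin n) (minimal : MinDegree G v) where

  open Neighbourhood k G v

  C₀ : IsCopy k G
  C₀ = proj₁ (proj₁ single v)

  v∈C₀ : InCopy G v C₀
  v∈C₀ = proj₂ (proj₁ single v)

  C₀⊆K : ∀ i → inK (proj₁ C₀ i) ≡ true
  C₀⊆K i = copy⊆K C₀ v∈C₀ (i , refl)

  k≤1+deg : k ≤ suc (deg G v)
  k≤1+deg = subst (k ≤_) count-inK (injection⇒≤count inK (proj₁ C₀) (proj₁ (proj₂ C₀)) C₀⊆K)

  -- Follow a chain of edge-sharing copies from C₀ to a copy through y: the
  -- first copy that leaves K(v) avoids v, and its shared edge lies in S(v).
  edge-in-S : ∀ y → inK y ≡ false →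
    ∃ λ u → ∃ λ w → u ≢ w × Edge G u w × inS u ≡ true × inS w ≡ true
  edge-in-S y y∉K with proj₁ single y
  ... | D , (i , Di≡y)
    with Star-boundary (λ C → Fin.all? (λ i → inK (proj₁ C i) Bool.≟ true))
           (proj₂ (proj₂ single) C₀ D) C₀⊆K
           (λ D⊆K → contradiction (trans (sym y∉K) (subst (λ z → inK z ≡ true) Di≡y (D⊆K i))) λ ())
  ... | C₁ , C₂ , C₁⊆K , C₂⊈K , (u , w , u≢w , uw , u∈C₁ , w∈C₁ , u∈C₂ , w∈C₂) =
    u , w , u≢w , uw , in-S u∈C₁ u∈C₂ , in-S w∈C₁ w∈C₂
    where
    v∉C₂ : ¬ InCopy G v C₂
    v∉C₂ v∈C₂ = C₂⊈K (λ i → copy⊆K C₂ v∈C₂ (i , refl))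
    in-S : ∀ {z} → InCopy G z C₁ → InCopy G z C₂ → inS z ≡ true
    in-S {z} (j , refl) z∈C₂ =
      proj₁ (inS-indicates z) (proj₂ (inK-indicates z) (C₁⊆K j) , ¬Rv-of-copy C₂ v∉C₂ z∈C₂)

  Rv-neighbour-in-K : ∀ {z y} → Rv k G v z → Edge G z y → inK y ≡ true
  Rv-neighbour-in-K (inj₁ refl) zy = proj₁ (inK-indicates _) (inj₂ zy)
  Rv-neighbour-in-K {z} {y} (inj₂ (_ , z⇒v)) zy with proj₁ (proj₂ single) z y zy
  ... | E , z∈E , y∈E = copy⊆K E (z⇒v E z∈E) y∈E

  configX : suc (deg G v) ≡ k → suc k ≤ n → Holds k G v (X (count inR))
  configX 1+deg≡k k<n =
    1≤count-inR , split-bound (count inR) (count inS) k 2 R+S≡k 2≤count-inS ,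
    subst (IsK G (Kv G v)) count-inK≡k (clique⇒IsK G inK inK-indicates K-clique) ,
    clique⇒IsK G inR inR-indicates (IsClique-⊆ G inR⇒inK K-clique) ,
    subst (IsK G (Sv k G v)) count-inS≡k∸r (clique⇒IsK G inS inS-indicates (IsClique-⊆ G inS⇒inK K-clique))
    where
    count-inK≡k : count inK ≡ k
    count-inK≡k = trans count-inK 1+deg≡k

    K-clique : IsClique G inK
    K-clique x y Kx Ky = InCopy-adjacent G C₀ (K⊆C₀ Kx) (K⊆C₀ Ky)
      where
      K⊆C₀ : ∀ {x} → inK x ≡ true → InCopy G x C₀
      K⊆C₀ {x} = injection-onto inK (proj₁ C₀) (proj₁ (proj₂ C₀)) C₀⊆K (≤-reflexive count-inK≡k) x

    R+S≡k : count inR + count inS ≡ k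
    R+S≡k = trans (sym count-inK-split) count-inK≡k

    count-inS≡k∸r : count inS ≡ k ∸ count inR
    count-inS≡k∸r = trans (sym (m+n∸m≡n (count inR) (count inS))) (cong (_∸ count inR) R+S≡k)

    2≤count-inS : 2 ≤ count inS
    2≤count-inS with count<⇒∃-false inK (subst (_< n) (sym count-inK≡k) k<n)
    ... | y , y∉K with edge-in-S y y∉K
    ...   | u , w , u≢w , _ , Su , Sw = count-≥2 inS Su Sw u≢w

  module DegreeK (deg≡k : deg G v ≡ k) where

    count-inK≡1+k : count inK ≡ suc k
    count-inK≡1+k = trans count-inK (cong suc deg≡k)

    -- Opaque, so that a and b below stay atomic when types are compared.
    opaque
      copy-misses-one : (C : IsCopy k G) → InCopy G v C →
        ∃ λ x → inK x ≡ true × ¬ InCopy G x C × ∀ {y} → inK y ≡ true → y ≢ x → InCopy G y C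
      copy-misses-one C v∈C with ∃-missed-by inK (proj₁ C) (≤-reflexive (sym count-inK≡1+k))
      ... | x , Kx , x∉C = x , Kx , x∉C , λ {y} Ky y≢x →
        decidable-stable (InCopy? G y C) λ y∉C →
          y≢x (injection-misses-at-most-one inK (proj₁ C) (proj₁ (proj₂ C)) (λ i → copy⊆K C v∈C (i , refl))
                 (≤-reflexive count-inK≡1+k) x y Kx Ky x∉C y∉C)

    a : Fin n
    a = proj₁ (copy-misses-one C₀ v∈C₀)

    a∈K : inK a ≡ true
    a∈K = proj₁ (proj₂ (copy-misses-one C₀ v∈C₀))

    a∉C₀ : ¬ InCopy G a C₀
    a∉C₀ = proj₁ (proj₂ (proj₂ (copy-misses-one C₀ v∈C₀)))

    inC₀ : ∀ {y} → inK y ≡ true → y ≢ a → InCopy G y C₀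
    inC₀ = proj₂ (proj₂ (proj₂ (copy-misses-one C₀ v∈C₀)))

    va : Edge G v a
    va with proj₂ (inK-indicates a) a∈K
    ... | inj₁ a≡v = contradiction (subst (λ z → InCopy G z C₀) (sym a≡v) v∈C₀) a∉C₀
    ... | inj₂ va   = va

    B : IsCopy k G
    B = proj₁ (proj₁ (proj₂ single) v a va)

    v∈B : InCopy G v B
    v∈B = proj₁ (proj₂ (proj₁ (proj₂ single) v a va))

    a∈B : InCopy G a B
    a∈B = proj₂ (proj₂ (proj₁ (proj₂ single) v a va))

    b : Fin n
    b = proj₁ (copy-misses-one B v∈B)

    b∈K : inK b ≡ true
    b∈K = proj₁ (proj₂ (copy-misses-one B v∈B))

    b∉B : ¬ InCopy G b B
    b∉B = proj₁ (proj₂ (proj₂ (copy-misses-one B v∈B)))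

    inB : ∀ {y} → inK y ≡ true → y ≢ b → InCopy G y B
    inB = proj₂ (proj₂ (proj₂ (copy-misses-one B v∈B)))

    a≢b : a ≢ b
    a≢b a≡b = b∉B (subst (λ z → InCopy G z B) a≡b a∈B)

    K-clique-except : IsCliqueExcept G inK a b
    K-clique-except x y Kx Ky x≢y ¬ab ¬ba with x ≟ a | y ≟ a
    ... | no x≢a   | no y≢a = InCopy-adjacent G C₀ (inC₀ Kx x≢a) (inC₀ Ky y≢a) x≢y
    ... | yes refl | _      = InCopy-adjacent G B (inB Kx a≢b) (inB Ky (λ y≡b → ¬ab (refl , y≡b))) x≢y
    ... | no _     | yes refl = InCopy-adjacent G B (inB Kx (λ x≡b → ¬ba (x≡b , refl))) (inB Ky a≢b) x≢y

    configU : adj G a b ≡ true → Holds k G v U₁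
    configU ab =
      subst (IsK G (Kv G v)) count-inK≡1+k (clique⇒IsK G inK inK-indicates K-clique) ,
      singleton⇒IsK G v Rv⇔v ,
      subst (IsK G (Sv k G v)) deg≡k (clique⇒IsK G (adj G v) N-indicates-S N-clique)
      where
      K-clique : IsClique G inK
      K-clique x y Kx Ky x≢y with x ≟ a ×-dec y ≟ b | x ≟ b ×-dec y ≟ a
      ... | yes (refl , refl) | _                 = ab
      ... | no _              | yes (refl , refl) = trans (adj-sym G b a) ab
      ... | no ¬ab            | no ¬ba            = K-clique-except x y Kx Ky x≢y ¬ab ¬ba

      N-clique : IsClique G (adj G v)
      N-clique = IsClique-⊆ G (λ x vx → proj₁ (inK-indicates x) (inj₂ vx)) K-clique

      -- N(v) is a copy of K_k avoiding v, so no neighbour of v lies in R(v).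
      N-copy : Σ (IsCopy k G) λ C → Indicates (adj G v) (λ x → InCopy G x C)
      N-copy = subst (λ t → Σ (IsCopy t G) λ C → Indicates (adj G v) (λ x → InCopy G x C)) deg≡k
                     (clique⇒IsCopy G (adj G v) N-clique)

      Rv⇔v : ∀ x → (Rv k G v x → x ≡ v) × (x ≡ v → Rv k G v x)
      Rv⇔v x = R⇒v , inj₁
        where
        R⇒v : Rv k G v x → x ≡ v
        R⇒v (inj₁ x≡v) = x≡v
        R⇒v (inj₂ (vx , x⇒v)) with N-copy
        ... | C , N≈C = contradiction (proj₁ (N≈C v) (x⇒v C (proj₂ (N≈C x) vx))) (Edge-irrefl G)

      N-indicates-S : Indicates (adj G v) (Sv k G v)
      N-indicates-S x = (λ { (inj₁ x≡v , ¬Rx) → contradiction (inj₁ x≡v) ¬Rx ; (inj₂ vx , _) → vx }) ,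
                        (λ vx → inj₂ vx , λ Rx → Edge-irrefl G (subst (Edge G v) (proj₁ (Rv⇔v x) Rx) vx))

    configY : adj G a b ≡ false → Holds k G v (Y (count inR))
    configY ab-free =
      1≤count-inR , r≤k∸2 ,
      subst (IsK⁻ G (Kv G v)) count-inK≡1+k
        (cliqueExcept⇒IsK⁻ G inK inK-indicates a∈K b∈K a≢b ab-free K-clique-except) ,
      clique⇒IsK G inR inR-indicates R-clique ,
      subst (IsK⁻ G (Sv k G v)) count-inS≡1+k∸r
        (cliqueExcept⇒IsK⁻ G inS inS-indicates a∈S b∈S a≢b ab-free (IsCliqueExcept-⊆ G inS⇒inK K-clique-except))
      where
      -- A vertex adjacent to neither a nor b has fewer than k = deg v neighbours inside K(v).
      neighbour-outside-K : ∀ z → adj G z a ≡ false → adj G z b ≡ false →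
        ∃ λ y → Edge G z y × inK y ≡ false
      neighbour-outside-K z za zb =
        decidable-stable (Fin.any? (λ y → (adj G z y Bool.≟ true) ×-dec (inK y Bool.≟ false))) λ none →
          <-irrefl refl (begin-strict
            count rest              <⟨ n<1+n (count rest) ⟩
            suc (count rest)        ≡⟨ suc-injective (trans (sym count-rest) count-inK≡1+k) ⟩
            k                       ≡⟨ sym deg≡k ⟩
            deg G v                 ≤⟨ minimal z ⟩
            deg G z                 ≤⟨ count-mono (adj G z) rest (N[z]⊆rest none) ⟩
            count rest              ∎)
        where
        open ≤-Reasoning
        rest : Fin n → Bool
        rest = without b (without a inK)
        count-rest : count inK ≡ suc (suc (count rest))
        count-rest = trans (count-without inK a a∈K)
          (cong suc (count-without (without a inK) b (without-true inK (a≢b ∘ sym) b∈K)))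
        N[z]⊆rest : ¬ (∃ λ y → Edge G z y × inK y ≡ false) → ∀ y → Edge G z y → rest y ≡ true
        N[z]⊆rest none y zy =
          without-true (without a inK) {b} {y} (λ { refl → contradiction (trans (sym zb) zy) λ () })
            (without-true inK {a} {y} (λ { refl → contradiction (trans (sym za) zy) λ () })
              (Bool.¬-not (λ y∉K → none (y , zy , y∉K))))

      ¬Rv-of-outside-neighbour : ∀ {z} → adj G z a ≡ false → adj G z b ≡ false → ¬ Rv k G v z
      ¬Rv-of-outside-neighbour {z} za zb Rz with neighbour-outside-K z za zb
      ... | y , zy , y∉K = contradiction (trans (sym y∉K) (Rv-neighbour-in-K Rz zy)) λ ()

      a∉R : ¬ Rv k G v a
      a∉R = ¬Rv-of-outside-neighbour (adj-irrefl G a) ab-free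

      b∉R : ¬ Rv k G v b
      b∉R = ¬Rv-of-outside-neighbour (trans (adj-sym G b a) ab-free) (adj-irrefl G b)

      in-S : ∀ {x} → inK x ≡ true → ¬ Rv k G v x → inS x ≡ true
      in-S {x} Kx ¬Rx = proj₁ (inS-indicates x) (proj₂ (inK-indicates x) Kx , ¬Rx)

      a∈S : inS a ≡ true
      a∈S = in-S a∈K a∉R

      b∈S : inS b ≡ true
      b∈S = in-S b∈K b∉R

      3≤count-inS : 3 ≤ count inS
      3≤count-inS with neighbour-outside-K a (adj-irrefl G a) ab-free
      ... | y , _ , y∉K with edge-in-S y y∉K
      ... | u , w , _ , uw , u∈S , w∈S with Edge-avoids-non-edge G ab-free uw
      ... | inj₁ (u≢a , u≢b) = count-≥3 inS a∈S b∈S u∈S a≢b (u≢a ∘ sym) (u≢b ∘ sym)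
      ... | inj₂ (w≢a , w≢b) = count-≥3 inS a∈S b∈S w∈S a≢b (w≢a ∘ sym) (w≢b ∘ sym)

      R-clique : IsClique G inR
      R-clique x y Rx Ry x≢y = K-clique-except x y (inR⇒inK x Rx) (inR⇒inK y Ry) x≢y
        (λ { (x≡a , _) → a∉R (subst (Rv k G v) x≡a (proj₂ (inR-indicates x) Rx)) })
        (λ { (x≡b , _) → b∉R (subst (Rv k G v) x≡b (proj₂ (inR-indicates x) Rx)) })

      R+S≡1+k : count inR + count inS ≡ suc k
      R+S≡1+k = trans (sym count-inK-split) count-inK≡1+k

      r≤k∸2 : count inR ≤ k ∸ 2
      r≤k∸2 = split-bound (count inR) (count inS) (suc k) 3 R+S≡1+k 3≤count-inS

      count-inS≡1+k∸r : count inS ≡ suc (k ∸ count inR)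
      count-inS≡1+k∸r = begin-equality
        count inS                  ≡⟨ m+n∸m≡n (count inR) (count inS) ⟨
        count inR + count inS ∸ count inR ≡⟨ cong (_∸ count inR) R+S≡1+k ⟩
        suc k ∸ count inR          ≡⟨ +-∸-assoc 1 (≤-trans r≤k∸2 (m∸n≤m k 2)) ⟩
        suc (k ∸ count inR)        ∎
        where open ≤-Reasoning

    config : Σ Config (Holds k G v)
    config with adj G a b in ab
    ... | true  = U₁ , configU ab
    ... | false = Y (count inR) , configY ab

  config : mBelowHalf G k → suc k ≤ n → Σ Config (Holds k G v)
  config m<k+1/2 k<n with m≤n⇒m<n∨m≡n (minDegree≤ k G m<k+1/2 v minimal)
  ... | inj₁ deg<k = X (count inR) , configX (≤-antisym deg<k k≤1+deg) k<n
  ... | inj₂ deg≡k = DegreeK.config deg≡k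

Holds-unique : ∀ {n} k (G : Graph n) v c c′ → Holds (suc k) G v c → Holds (suc k) G v c′ → c′ ≡ c
Holds-unique k G v (X ℓ) (X ℓ′) (_ , _ , _ , R , _) (_ , _ , _ , R′ , _) = cong X (InducedIso-size-unique {G = G} R′ R)
Holds-unique k G v (Y ℓ) (Y ℓ′) (_ , _ , _ , R , _) (_ , _ , _ , R′ , _) = cong Y (InducedIso-size-unique {G = G} R′ R)
Holds-unique k G v U₁ U₁ _ _ = refl
Holds-unique k G v (X ℓ) (Y ℓ′) (_ , _ , K , _) (_ , _ , K′ , _) =
  contradiction (InducedIso-size-unique {G = G} K′ K) 1+n≢n
Holds-unique k G v (X ℓ) U₁ (_ , _ , K , _) (K′ , _) =
  contradiction (InducedIso-size-unique {G = G} K′ K) 1+n≢n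
Holds-unique k G v (Y ℓ) (X ℓ′) (_ , _ , K , _) (_ , _ , K′ , _) =
  contradiction (InducedIso-size-unique {G = G} K K′) 1+n≢n
Holds-unique k G v U₁ (X ℓ′) (K , _) (_ , _ , K′ , _) =
  contradiction (InducedIso-size-unique {G = G} K K′) 1+n≢n
Holds-unique k G v (Y ℓ) U₁ (_ , _ , K , _) (K′ , _) = ⊥-elim (¬IsK⁻×IsK G (Kv G v) k K K′)
Holds-unique k G v U₁ (Y ℓ′) (K , _) (_ , _ , K′ , _) = ⊥-elim (¬IsK⁻×IsK G (Kv G v) k K′ K)

proposition2p5 : (k n : ℕ) → 5 ≤ k → suc k ≤ n → (G : Graph n) →
    Connected G → mBelowHalf G k → SingleKComponent k G →
    (v : Fin n) → MinDegree G v →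
    Σ Config (λ c → Holds k G v c × ((c′ : Config) → Holds k G v c′ → c′ ≡ c))
proposition2p5 (suc k) n (s≤s _) k<n G _ m<k+1/2 single v minimal
  with AtMinDegreeVertex.config (suc k) G single v minimal m<k+1/2 k<n
... | c , holds = c , holds , λ c′ holds′ → Holds-unique k G v c c′ holds holds′
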